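{- Let $\mathfrak{F}$ be a CI frame closed under marginalization, intersection, and lifting. Then for all finite sets $N,M$ with $|N\cap M|\le1$ and all $\mathcal{M}\in\mathfrak{F}(N)$, $\mathcal{A}\in\mathfrak{F}(M)$, there exists an adhesion $\mathcal{Z}\in\mathfrak{F}(N\cup M)$ of $\mathcal{M}$ and $\mathcal{A}$.
   Context: For a finite set $N$, $\mathbb{S}(N)$ denotes the set of all CI statements $ij|K$ with $i,j\in N$ distinct and $K\subseteq N\setminus\{i,j\}$, with $ij|K$ and $ji|K$ identified; juxtaposition denotes union. A CI model over $N$ is a subset of $\mathbb{S}(N)$. A CI frame $\mathfrak{F}$ assigns to every finite set $N$ a set $\mathfrak{F}(N)$ of models over $N$ with $\mathbb{S}(N)\in\mathfrak{F}(N)$. Marginal: $\mathcal{M}^{\downarrow M}=\mathcal{M}\cap\mathbb{S}(M)$ for $M\subseteq N$; closed under marginalization if $\mathcal{M}\in\mathfrak{F}(N)$, $M\subseteq N$ imply $\mathcal{M}^{\downarrow M}\in\mathfrak{F}(M)$. Closed under intersection: $\mathcal{M},\mathcal{A}\in\mathfrak{F}(N)\Rightarrow\mathcal{M}\cap\mathcal{A}\in\mathfrak{F}(N)$. Lift: for $N\subseteq O$, $\mathcal{M}_{N\uparrow O}=\{ij|K\in\mathbb{S}(O):\{i,j\}\cap(O\setminus N)\neq\emptyset\text{ or } ij|(K\cap N)\in\mathcal{M}\}$; closed under lifting if $\mathcal{M}\in\mathfrak{F}(N)$, $N\subseteq O$ imply $\mathcal{M}_{N\uparrow O}\in\mathfrak{F}(O)$.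 For pairwise disjoint $I,J,K$, $I\perp J\,|\,K\,[\mathcal{Z}]$ means $ij|L'\in\mathcal{Z}$ for all $i\in I$, $j\in J$, $K\subseteq L'\subseteq(I\cup J\cup K)\setminus\{i,j\}$. For $\mathcal{M}\subseteq\mathbb{S}(N)$, $\mathcal{A}\subseteq\mathbb{S}(M)$, an adhesion of $\mathcal{M}$ and $\mathcal{A}$ is $\mathcal{Z}\subseteq\mathbb{S}(N\cup M)$ with $\mathcal{Z}^{\downarrow N}=\mathcal{M}$, $\mathcal{Z}^{\downarrow M}=\mathcal{A}$, and $(N\setminus M)\perp(M\setminus N)\,|\,(N\cap M)\,[\mathcal{Z}]$. -}

module Defs where

open import Level using (Level; suc; _⊔_) renaming (zero to lzero)
open import Data.Nat using (ℕ)
open import Data.Fin using (Fin)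
open import Data.Fin.Subset using (Subset; _∈_; _∉_; _⊆_; _∩_; _∪_; _─_)
open import Data.Product using (_×_; Σ)
open import Data.Sum using (_⊎_)
open import Relation.Binary.PropositionalEquality using (_≢_)
open import Function.Bundles using (_⇔_)

-- Ground set: finite sets are the subsets N of Fin n (n arbitrary).
-- A CI statement ij|K is encoded by a triple (i , j , K); a CI model is a
-- predicate on such triples.  Models over N are required (see ModelOver)
-- to contain only triples in S(N) and to be symmetric in i,j, so that
-- ij|K and ji|K are identified.

Model : ℕ → Set₁
Model n = Fin n → Fin n → Subset n → Set

𝕊 : ∀ {n} → Subset n → Model n
𝕊 N i j K = (i ≢ j) × (i ∈ N) × (j ∈ N) × (K ⊆ N) × (i ∉ K) × (j ∉ K)

record ModelOver {n} (N : Subset n) (𝓜 : Model n) : Set where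
  field
    sub : ∀ i j K → 𝓜 i j K → 𝕊 N i j K
    sym : ∀ i j K → 𝓜 i j K → 𝓜 j i K

_≐_ : ∀ {n} → Model n → Model n → Set
𝓜 ≐ 𝓐 = ∀ i j K → 𝓜 i j K ⇔ 𝓐 i j K

_↓_ : ∀ {n} → Model n → Subset n → Model n
(𝓜 ↓ M) i j K = 𝓜 i j K × 𝕊 M i j K

_⊓_ : ∀ {n} → Model n → Model n → Model n
(𝓜 ⊓ 𝓐) i j K = 𝓜 i j K × 𝓐 i j K

lift : ∀ {n} → Subset n → Subset n → Model n → Model n
lift N O 𝓜 i j K =
  𝕊 O i j K × ((i ∈ (O ─ N) ⊎ j ∈ (O ─ N)) ⊎ 𝓜 i j (K ∩ N))

record CIFrame (n : ℕ) : Set₂ where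
  field
    𝔉    : Subset n → Model n → Set₁
    over : ∀ {N 𝓜} → 𝔉 N 𝓜 → ModelOver N 𝓜
    full : ∀ N → 𝔉 N (𝕊 N)
    resp : ∀ {N 𝓜 𝓐} → 𝔉 N 𝓜 → 𝓜 ≐ 𝓐 → 𝔉 N 𝓐

module _ {n : ℕ} (F : CIFrame n) where
  open CIFrame F

  ClosedUnderMarginalization : Set₁
  ClosedUnderMarginalization =
    ∀ N M 𝓜 → M ⊆ N → 𝔉 N 𝓜 → 𝔉 M (𝓜 ↓ M)

  ClosedUnderIntersection : Set₁
  ClosedUnderIntersection =
    ∀ N 𝓜 𝓐 → 𝔉 N 𝓜 → 𝔉 N 𝓐 → 𝔉 N (𝓜 ⊓ 𝓐)

  ClosedUnderLifting : Set₁
  ClosedUnderLifting =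
    ∀ N O 𝓜 → N ⊆ O → 𝔉 N 𝓜 → 𝔉 O (lift N O 𝓜)

Indep : ∀ {n} → Subset n → Subset n → Subset n → Model n → Set
Indep I J K 𝓩 =
  ∀ i j L → i ∈ I → j ∈ J → K ⊆ L → L ⊆ (I ∪ J ∪ K) → i ∉ L → j ∉ L → 𝓩 i j L

record IsAdhesion {n} (N M : Subset n) (𝓜 𝓐 𝓩 : Model n) : Set where
  field
    overNM : ModelOver (N ∪ M) 𝓩
    margN  : (𝓩 ↓ N) ≐ 𝓜
    margM  : (𝓩 ↓ M) ≐ 𝓐
    indep  : Indep (N ─ M) (M ─ N) (N ∩ M) 𝓩

{-# OPTIONS --safe #-}
-- Take the intersection 𝓩 of the lifts of 𝓜 and 𝓐 to N ∪ M.  A lift contains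
-- every statement with a leg outside the original ground set, so a statement
-- ij|L with i ∈ N ─ M and j ∈ M ─ N lies in both lifts: this is the
-- independence.  Since N ∩ M has at most one element, every statement of 𝕊(N)
-- has a leg outside M, so the lift of 𝓐 contains all of 𝕊(N) and the marginal
-- of 𝓩 on N is the marginal of the lift of 𝓜, which is 𝓜; symmetrically for M.
module Submission where

open import Defs
open import Data.Nat using (ℕ; _≤_; _<_)
open import Data.Nat.Properties using (<-≤-trans; n≮n)
open import Data.Fin using (_≟_)
open import Data.Fin.Subset
  using (Subset; ∣_∣; _∩_; _∪_; _─_; ⁅_⁆; inside; outside; _∈_; _∉_; _⊆_; _⊂_)
open import Data.Fin.Subset.Properties
  using ( _∈?_; ⊆-antisym; p⊂q⇒∣p∣<∣q∣; x∈⁅y⁆⇒x≡y; x≢y⇒x∉⁅y⁆; ∣⁅x⁆∣≡1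
        ; p∩q⊆p; x∈p∩q⁺; ∩-comm; p⊆p∪q; q⊆p∪q; x∈p∪q⁻
        ; p─q⊆p; x∈p∧x∉q⇒x∈p─q )
open import Data.Vec.Base using (_∷_; here; there)
open import Data.Product using (Σ; _×_; _,_; proj₁)
open import Data.Sum using (_⊎_; inj₁; inj₂; swap) renaming (map to ⊎-map)
open import Function using (_∘_)
open import Function.Bundles using (mk⇔)
open import Function.Properties.Equivalence using () renaming (trans to ⇔-trans)
open import Relation.Nullary using (yes; no; contradiction)
open import Relation.Binary.PropositionalEquality using (_≡_; _≢_; refl; sym; subst)

private
  variable
    n : ℕ
    N M O : Subset n
    𝓜 𝓐 𝓑 : Model n

x∈p─q⇒x∉q : ∀ (p q : Subset n) {x} → x ∈ p ─ q → x ∉ q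
x∈p─q⇒x∉q (inside ∷ p) (outside ∷ q) here ()
x∈p─q⇒x∉q (_ ∷ p) (_ ∷ q) (there x∈p─q) (there x∈q) = x∈p─q⇒x∉q p q x∈p─q x∈q

p⊆q⇒p∩q≡p : ∀ {p q : Subset n} → p ⊆ q → p ∩ q ≡ p
p⊆q⇒p∩q≡p {p = p} {q} p⊆q = ⊆-antisym (p∩q⊆p p q) (λ x∈p → x∈p∩q⁺ (x∈p , p⊆q x∈p))

∣p∣≤1⇒x≡y : ∀ {p : Subset n} {x y} → ∣ p ∣ ≤ 1 → x ∈ p → y ∈ p → x ≡ y
∣p∣≤1⇒x≡y {p = p} {x} {y} ∣p∣≤1 x∈p y∈p with x ≟ y
... | yes x≡y = x≡y
... | no x≢y = contradiction (<-≤-trans 1<∣p∣ ∣p∣≤1) (n≮n 1)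
  where
  ⁅x⁆⊂p : ⁅ x ⁆ ⊂ p
  ⁅x⁆⊂p = (λ z∈⁅x⁆ → subst (_∈ p) (sym (x∈⁅y⁆⇒x≡y x z∈⁅x⁆)) x∈p)
        , y , y∈p , x≢y⇒x∉⁅y⁆ (x≢y ∘ sym)
  1<∣p∣ : 1 < ∣ p ∣
  1<∣p∣ = subst (_< ∣ p ∣) (∣⁅x⁆∣≡1 x) (p⊂q⇒∣p∣<∣q∣ ⁅x⁆⊂p)

∣p∩q∣≤1⇒x∉q⊎y∉q : ∀ {p q : Subset n} {x y} →
                   ∣ p ∩ q ∣ ≤ 1 → x ∈ p → y ∈ p → x ≢ y → x ∉ q ⊎ y ∉ q
∣p∩q∣≤1⇒x∉q⊎y∉q {q = q} {x} {y} ∣p∩q∣≤1 x∈p y∈p x≢y with x ∈? q | y ∈? q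
... | no x∉q  | _       = inj₁ x∉q
... | yes _   | no y∉q  = inj₂ y∉q
... | yes x∈q | yes y∈q =
  contradiction (∣p∣≤1⇒x≡y ∣p∩q∣≤1 (x∈p∩q⁺ (x∈p , x∈q)) (x∈p∩q⁺ (y∈p , y∈q))) x≢y

p─q∪q─p∪p∩q⊆p∪q : ∀ (p q : Subset n) → (p ─ q) ∪ (q ─ p) ∪ (p ∩ q) ⊆ p ∪ q
p─q∪q─p∪p∩q⊆p∪q p q x∈ with x∈p∪q⁻ _ _ x∈
... | inj₁ x∈p─q = p⊆p∪q q (p─q⊆p p q x∈p─q)
... | inj₂ x∈rest with x∈p∪q⁻ _ _ x∈rest
...   | inj₁ x∈q─p = q⊆p∪q p q (p─q⊆p q p x∈q─p)
...   | inj₂ x∈p∩q = p⊆p∪q q (p∩q⊆p p q x∈p∩q)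

_⊑_ : Model n → Model n → Set
𝓜 ⊑ 𝓐 = ∀ {i j K} → 𝓜 i j K → 𝓐 i j K

≐-trans : 𝓜 ≐ 𝓐 → 𝓐 ≐ 𝓑 → 𝓜 ≐ 𝓑
≐-trans 𝓜≐𝓐 𝓐≐𝓑 i j K = ⇔-trans (𝓜≐𝓐 i j K) (𝓐≐𝓑 i j K)

𝕊-mono : N ⊆ O → 𝕊 N ⊑ 𝕊 O
𝕊-mono N⊆O (i≢j , i∈N , j∈N , K⊆N , i∉K , j∉K) =
  i≢j , N⊆O i∈N , N⊆O j∈N , (λ k∈K → N⊆O (K⊆N k∈K)) , i∉K , j∉K

𝕊-sym : ∀ {i j K} → 𝕊 N i j K → 𝕊 N j i K
𝕊-sym (i≢j , i∈N , j∈N , K⊆N , i∉K , j∉K) = i≢j ∘ sym , j∈N , i∈N , K⊆N , j∉K , i∉K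

⊓-modelOver : ModelOver N 𝓜 → ModelOver N 𝓐 → ModelOver N (𝓜 ⊓ 𝓐)
⊓-modelOver 𝓜-over 𝓐-over = record
  { sub = λ i j K (m , _) → ModelOver.sub 𝓜-over i j K m
  ; sym = λ i j K (m , a) → ModelOver.sym 𝓜-over i j K m , ModelOver.sym 𝓐-over i j K a
  }

lift-modelOver : ModelOver N 𝓜 → ModelOver O (lift N O 𝓜)
lift-modelOver {N = N} 𝓜-over = record
  { sub = λ _ _ _ → proj₁
  ; sym = λ where
      i j K (s , inj₁ leg) → 𝕊-sym s , inj₁ (swap leg)
      i j K (s , inj₂ m)   → 𝕊-sym s , inj₂ (ModelOver.sym 𝓜-over i j (K ∩ N) m)
  }

lift-↓ : N ⊆ O → ModelOver N 𝓜 → (lift N O 𝓜 ↓ N) ≐ 𝓜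
lift-↓ {N = N} {O} {𝓜 = 𝓜} N⊆O 𝓜-over i j K = mk⇔ to from
  where
  to : (lift N O 𝓜 ↓ N) i j K → 𝓜 i j K
  to ((_ , inj₁ (inj₁ i∈O─N)) , (_ , i∈N , _)) = contradiction i∈N (x∈p─q⇒x∉q O N i∈O─N)
  to ((_ , inj₁ (inj₂ j∈O─N)) , (_ , _ , j∈N , _)) = contradiction j∈N (x∈p─q⇒x∉q O N j∈O─N)
  to ((_ , inj₂ m) , (_ , _ , _ , K⊆N , _)) = subst (𝓜 i j) (p⊆q⇒p∩q≡p K⊆N) m
  from : 𝓜 i j K → (lift N O 𝓜 ↓ N) i j K
  from m with ModelOver.sub 𝓜-over i j K m
  ... | s@(_ , _ , _ , K⊆N , _) =
    (𝕊-mono N⊆O s , inj₂ (subst (𝓜 i j) (sym (p⊆q⇒p∩q≡p K⊆N)) m)) , s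

𝕊⊑lift : N ⊆ O → ∣ N ∩ M ∣ ≤ 1 → 𝕊 N ⊑ lift M O 𝓐
𝕊⊑lift {N = N} {O} {M} N⊆O ∣N∩M∣≤1 s@(i≢j , i∈N , j∈N , _) =
  𝕊-mono N⊆O s , inj₁ (⊎-map (leg i∈N) (leg j∈N) (∣p∩q∣≤1⇒x∉q⊎y∉q ∣N∩M∣≤1 i∈N j∈N i≢j))
  where
  leg : ∀ {x} → x ∈ N → x ∉ M → x ∈ O ─ M
  leg x∈N = x∈p∧x∉q⇒x∈p─q (N⊆O x∈N)

↓-⊓-absorbʳ : 𝕊 N ⊑ 𝓑 → ((𝓐 ⊓ 𝓑) ↓ N) ≐ (𝓐 ↓ N)
↓-⊓-absorbʳ 𝕊⊑𝓑 i j K = mk⇔ (λ ((a , _) , s) → a , s) (λ (a , s) → (a , 𝕊⊑𝓑 s) , s)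

↓-⊓-absorbˡ : 𝕊 N ⊑ 𝓐 → ((𝓐 ⊓ 𝓑) ↓ N) ≐ (𝓑 ↓ N)
↓-⊓-absorbˡ 𝕊⊑𝓐 i j K = mk⇔ (λ ((_ , b) , s) → b , s) (λ (b , s) → (𝕊⊑𝓐 s , b) , s)

lift⊓lift-indep : Indep (N ─ M) (M ─ N) (N ∩ M) (lift N (N ∪ M) 𝓜 ⊓ lift M (N ∪ M) 𝓐)
lift⊓lift-indep {N = N} {M} i j L i∈N─M j∈M─N _ L⊆ i∉L j∉L =
  (s , inj₁ (inj₂ (x∈p∧x∉q⇒x∈p─q (q⊆p∪q N M j∈M) j∉N))) ,
  (s , inj₁ (inj₁ (x∈p∧x∉q⇒x∈p─q (p⊆p∪q M i∈N) (x∈p─q⇒x∉q N M i∈N─M))))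
  where
  i∈N = p─q⊆p N M i∈N─M
  j∈M = p─q⊆p M N j∈M─N
  j∉N = x∈p─q⇒x∉q M N j∈M─N
  s : 𝕊 (N ∪ M) i j L
  s = (λ { refl → j∉N i∈N }) , p⊆p∪q M i∈N , q⊆p∪q N M j∈M
    , (λ l∈L → p─q∪q─p∪p∩q⊆p∪q N M (L⊆ l∈L)) , i∉L , j∉L

lift⊓lift-isAdhesion : ∣ N ∩ M ∣ ≤ 1 → ModelOver N 𝓜 → ModelOver M 𝓐 →
                       IsAdhesion N M 𝓜 𝓐 (lift N (N ∪ M) 𝓜 ⊓ lift M (N ∪ M) 𝓐)
lift⊓lift-isAdhesion {N = N} {M} {𝓜} {𝓐} ∣N∩M∣≤1 𝓜-over 𝓐-over = record
  { overNM = ⊓-modelOver (lift-modelOver 𝓜-over) (lift-modelOver 𝓐-over)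
  ; margN  = ≐-trans (↓-⊓-absorbʳ (𝕊⊑lift {𝓐 = 𝓐} N⊆N∪M ∣N∩M∣≤1)) (lift-↓ N⊆N∪M 𝓜-over)
  ; margM  = ≐-trans (↓-⊓-absorbˡ (𝕊⊑lift {𝓐 = 𝓜} M⊆N∪M ∣M∩N∣≤1)) (lift-↓ M⊆N∪M 𝓐-over)
  ; indep  = lift⊓lift-indep {𝓜 = 𝓜} {𝓐 = 𝓐}
  }
  where
  N⊆N∪M = p⊆p∪q M
  M⊆N∪M = q⊆p∪q N M
  ∣M∩N∣≤1 = subst (λ X → ∣ X ∣ ≤ 1) (∩-comm N M) ∣N∩M∣≤1

lemma4p11 : (n : ℕ) (F : CIFrame n)
    → ClosedUnderMarginalization F
    → ClosedUnderIntersection F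
    → ClosedUnderLifting F
    → ∀ (N M : Subset n) → ∣ N ∩ M ∣ ≤ 1
    → ∀ 𝓜 𝓐 → CIFrame.𝔉 F N 𝓜 → CIFrame.𝔉 F M 𝓐
    → Σ (Model n) (λ 𝓩 → CIFrame.𝔉 F (N ∪ M) 𝓩 × IsAdhesion N M 𝓜 𝓐 𝓩)
lemma4p11 n F _ ∩-closed lift-closed N M ∣N∩M∣≤1 𝓜 𝓐 𝓜∈𝔉 𝓐∈𝔉 =
  lift N (N ∪ M) 𝓜 ⊓ lift M (N ∪ M) 𝓐 ,
  ∩-closed (N ∪ M) _ _ (lift-closed N (N ∪ M) 𝓜 (p⊆p∪q M) 𝓜∈𝔉)
                       (lift-closed M (N ∪ M) 𝓐 (q⊆p∪q N M) 𝓐∈𝔉) ,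
  lift⊓lift-isAdhesion ∣N∩M∣≤1 (over 𝓜∈𝔉) (over 𝓐∈𝔉)
  where open CIFrame F
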